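{- For every integer $n\ge1$, $$\mathrm{spt}(n)=d(n)+\sum_{k=1}^{n}\sum_{m=1}^{\lfloor n/k\rfloor}\sum_{\nu=1}^{k-1}(k-\nu)\,p(n-km,\nu),$$ where $d(n)$ is the number of positive divisors of $n$.
   Context: $p(n,k)$ is the number of partitions of $n$ into exactly $k$ positive parts, with the conventions $p(0,1)=1$ and $p(n,k)=0$ if $n<0$, $k<1$, or $k>n$. $\mathrm{spt}(n)$ (Andrews' smallest parts function) is the sum, over all partitions of $n$, of the number of occurrences of the smallest part in that partition. -}

module Defs where

open import Data.Nat using (ℕ; zero; suc; _+_; _*_; _∸_; _/_; _≤_; _<_; NonZero)
open import Data.Nat.Properties using (_≟_; _≤?_)
open import Data.Nat.Divisibility using (_∣?_)
open import Data.List using (List; []; _∷_; length; filter; map; concatMap; upTo; applyUpTo)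
open import Data.Nat.ListAction using (sum)
open import Relation.Nullary.Decidable using (⌊_⌋)
open import Data.Bool using (if_then_else_)

-- A partition is represented as a non-increasing list of positive parts.
-- parts≤ b n : all partitions of n (as non-increasing lists) whose parts are ≤ b.
-- Defined by recursion on fuel = n (enough since every part is ≥ 1).
partsUpTo : ℕ → ℕ → ℕ → List (List ℕ)
partsUpTo fuel b zero = [] ∷ []
partsUpTo zero b (suc n) = []
partsUpTo (suc fuel) b (suc n) =
  concatMap (λ i → let j = suc i in
                   if ⌊ j ≤? suc n ⌋
                   then map (j ∷_) (partsUpTo fuel j (suc n ∸ j))
                   else [])
            (upTo b)

partitions : ℕ → List (List ℕ)
partitions n = partsUpTo n n n

-- Number of occurrences of the smallest part of a partition (non-increasing list):
-- the smallest part is the last element.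
lastOr0 : List ℕ → ℕ
lastOr0 [] = 0
lastOr0 (x ∷ []) = x
lastOr0 (x ∷ y ∷ xs) = lastOr0 (y ∷ xs)

count : ℕ → List ℕ → ℕ
count a xs = length (filter (λ x → x ≟ a) xs)

smallestMult : List ℕ → ℕ
smallestMult xs = count (lastOr0 xs) xs

spt : ℕ → ℕ
spt n = sum (map smallestMult (partitions n))

-- p(n,k): number of partitions of n into exactly k positive parts,
-- with the convention p(0,1) = 1 (and p(0,k) = 0 for all other k).
p : ℕ → ℕ → ℕ
p zero (suc zero) = 1
p zero _ = 0
p (suc n) k = length (filter (λ π → length π ≟ k) (partitions (suc n)))

d : ℕ → ℕ
d n = length (filter (λ i → i ∣? n) (applyUpTo suc n))

Σ[1‥_] : ℕ → (ℕ → ℕ) → ℕ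
Σ[1‥ n ] f = sum (applyUpTo (λ i → f (suc i)) n)

-- Σ_{k=1}^{n} f k, where the summand may use that k is nonzero
-- (needed to divide by k).
Σ⁺[1‥_] : ℕ → ((k : ℕ) → .{{NonZero k}} → ℕ) → ℕ
Σ⁺[1‥ n ] f = sum (applyUpTo (λ i → f (suc i)) n)

{-# OPTIONS --safe #-}
-- Split spt n by the number k of parts: spt n = Σₖ sptₖ n, where sptₖ only counts
-- partitions with exactly k parts.  Adding a first column of height k to the Young
-- diagram maps the partitions of N with at most k parts bijectively onto those of
-- N + k with exactly k parts; it keeps the number of smallest parts when there are
-- already k parts, and otherwise creates k − ℓ new smallest parts equal to 1.  Hence
-- sptₖ (N + k) = sptₖ N + Σ_{λ ⊢ N} (k ∸ ℓ λ), and unrolling down to N < k, where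
-- sptₖ vanishes, gives sptₖ n = Σ_{m=1}^{⌊n/k⌋} Σ_{λ ⊢ n−km} (k ∸ ℓ λ).  Grouping
-- λ by its length ν gives Σ_ν (k − ν) p(n − km, ν), except that the empty partition
-- of 0 contributes k while the convention p(0,1) = 1 accounts for only k − 1; the
-- resulting extra 1 for each k dividing n sums to d n.
module Submission where

open import Defs
open import Data.Nat using (ℕ; zero; suc; _+_; _*_; _∸_; _/_; _%_; _≤_; _<_; z≤n; s≤s; s≤s⁻¹; z<s; s<s; NonZero)
open import Data.Nat.Properties
open import Data.Nat.DivMod using (m≡m%n+[m/n]*n; m%n<n; m≥n⇒m/n>0)
open import Data.Nat.Divisibility using (_∣?_)
open import Data.Nat.ListAction using (sum)
open import Data.Nat.ListAction.Properties using (sum-++)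
open import Data.List using (List; []; _∷_; _++_; length; filter; map; concatMap; upTo; applyUpTo; replicate)
open import Data.List.Properties
  using ( map-cong; map-++; map-upTo; map-applyUpTo; concatMap-cong; length-replicate; length-++; ++-identityʳ
        ; filter-++; filter-all; filter-none)
open import Data.List.Relation.Unary.All as All using (All; []; _∷_)
open import Data.List.Relation.Unary.All.Properties using (concat⁺; map⁺; replicate⁺)
open import Data.Bool using (true; false; if_then_else_)
open import Data.Product using (_×_; _,_; proj₁)
open import Function using (_∘_)
open import Relation.Nullary using (Dec; does; ¬_; yes; no; contradiction)
open import Relation.Nullary.Decidable using (⌊_⌋; dec-true; dec-false)
open import Relation.Unary using (Decidable)
open import Relation.Binary.Definitions using (tri<; tri≈; tri>)
open import Relation.Binary.PropositionalEquality
open import Algebra.Properties.CommutativeSemigroup +-commutativeSemigroup using (x∙yz≈y∙xz; interchange)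
open ≡-Reasoning

⟦_⟧ : {P : Set} → Dec P → ℕ
⟦ P? ⟧ = if does P? then 1 else 0

⟦⟧-yes : {P : Set} (P? : Dec P) → P → ⟦ P? ⟧ ≡ 1
⟦⟧-yes P? p = cong (if_then 1 else 0) (dec-true P? p)

⟦⟧-no : {P : Set} (P? : Dec P) → ¬ P → ⟦ P? ⟧ ≡ 0
⟦⟧-no P? ¬p = cong (if_then 1 else 0) (dec-false P? ¬p)

δ : ℕ → ℕ → ℕ
δ a b = ⟦ a ≟ b ⟧

δ-refl : ∀ a → δ a a ≡ 1
δ-refl a = ⟦⟧-yes (a ≟ a) refl

δ-≢ : ∀ {a b} → a ≢ b → δ a b ≡ 0
δ-≢ {a} {b} = ⟦⟧-no (a ≟ b)

sumMap : {A : Set} → (A → ℕ) → List A → ℕ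
sumMap f xs = sum (map f xs)

module _ {A : Set} where

  sumMap-cong : ∀ {f g : A → ℕ} → (∀ x → f x ≡ g x) → ∀ xs → sumMap f xs ≡ sumMap g xs
  sumMap-cong f≗g xs = cong sum (map-cong f≗g xs)

  sumMap-congᴬ : ∀ {f g : A → ℕ} {xs} → All (λ x → f x ≡ g x) xs → sumMap f xs ≡ sumMap g xs
  sumMap-congᴬ []         = refl
  sumMap-congᴬ (eq ∷ eqs) = cong₂ _+_ eq (sumMap-congᴬ eqs)

  sumMap-zeroᴬ : ∀ {f : A → ℕ} {xs} → All (λ x → f x ≡ 0) xs → sumMap f xs ≡ 0
  sumMap-zeroᴬ []         = refl
  sumMap-zeroᴬ (eq ∷ eqs) = cong₂ _+_ eq (sumMap-zeroᴬ eqs)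

  sumMap-+ : ∀ (f g : A → ℕ) xs → sumMap (λ x → f x + g x) xs ≡ sumMap f xs + sumMap g xs
  sumMap-+ f g []       = refl
  sumMap-+ f g (x ∷ xs) = trans (cong (f x + g x +_) (sumMap-+ f g xs)) (interchange (f x) (g x) _ _)

  sumMap-*ˡ : ∀ c (f : A → ℕ) xs → sumMap (λ x → c * f x) xs ≡ c * sumMap f xs
  sumMap-*ˡ c f []       = sym (*-zeroʳ c)
  sumMap-*ˡ c f (x ∷ xs) = trans (cong (c * f x +_) (sumMap-*ˡ c f xs)) (sym (*-distribˡ-+ c (f x) _))

  sumMap-map : ∀ {B : Set} (g : B → ℕ) (h : A → B) xs → sumMap g (map h xs) ≡ sumMap (g ∘ h) xs
  sumMap-map g h []       = refl
  sumMap-map g h (x ∷ xs) = cong (g (h x) +_) (sumMap-map g h xs)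

  sumMap-concatMap : ∀ {B : Set} (g : B → ℕ) (F : A → List B) xs →
                     sumMap g (concatMap F xs) ≡ sumMap (sumMap g ∘ F) xs
  sumMap-concatMap g F []       = refl
  sumMap-concatMap g F (x ∷ xs) = begin
    sum (map g (F x ++ concatMap F xs))         ≡⟨ cong sum (map-++ g (F x) _) ⟩
    sum (map g (F x) ++ map g (concatMap F xs)) ≡⟨ sum-++ (map g (F x)) _ ⟩
    sumMap g (F x) + sumMap g (concatMap F xs)  ≡⟨ cong (sumMap g (F x) +_) (sumMap-concatMap g F xs) ⟩
    sumMap (sumMap g ∘ F) (x ∷ xs)              ∎

  length-filter≡sumMap : ∀ {P : A → Set} (P? : Decidable P) xs →
                         length (filter P? xs) ≡ sumMap (λ x → ⟦ P? x ⟧) xs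
  length-filter≡sumMap P? []       = refl
  length-filter≡sumMap P? (x ∷ xs) with does (P? x)
  ... | true  = cong suc (length-filter≡sumMap P? xs)
  ... | false = length-filter≡sumMap P? xs

-- Σ[1‥ n ] f and Σ⁺[1‥ n ] f both unfold to sumUpTo (λ i → f (suc i)) n.
sumUpTo : (ℕ → ℕ) → ℕ → ℕ
sumUpTo f n = sum (applyUpTo f n)

sumUpTo-cong< : ∀ {f g : ℕ → ℕ} n → (∀ i → i < n → f i ≡ g i) → sumUpTo f n ≡ sumUpTo g n
sumUpTo-cong< zero    eq = refl
sumUpTo-cong< (suc n) eq = cong₂ _+_ (eq 0 z<s) (sumUpTo-cong< n (λ i i<n → eq (suc i) (s<s i<n)))

sumUpTo-cong : ∀ {f g : ℕ → ℕ} n → (∀ i → f i ≡ g i) → sumUpTo f n ≡ sumUpTo g n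
sumUpTo-cong n eq = sumUpTo-cong< n (λ i _ → eq i)

sumUpTo-zero : ∀ {f : ℕ → ℕ} n → (∀ i → f i ≡ 0) → sumUpTo f n ≡ 0
sumUpTo-zero zero    eq = refl
sumUpTo-zero (suc n) eq = cong₂ _+_ (eq 0) (sumUpTo-zero n (eq ∘ suc))

sumUpTo-truncate : ∀ {f : ℕ → ℕ} {b c} → c ≤ b → (∀ i → c ≤ i → f i ≡ 0) → sumUpTo f b ≡ sumUpTo f c
sumUpTo-truncate {b = b} z≤n      eq = sumUpTo-zero b (λ i → eq i z≤n)
sumUpTo-truncate {f}     (s≤s c≤b) eq = cong (f 0 +_) (sumUpTo-truncate c≤b (λ i c≤i → eq (suc i) (s≤s c≤i)))

sumUpTo-+ : ∀ (f g : ℕ → ℕ) n → sumUpTo (λ i → f i + g i) n ≡ sumUpTo f n + sumUpTo g n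
sumUpTo-+ f g zero    = refl
sumUpTo-+ f g (suc n) = trans (cong (f 0 + g 0 +_) (sumUpTo-+ (f ∘ suc) (g ∘ suc) n)) (interchange (f 0) (g 0) _ _)

sumUpTo-δ : ∀ {f : ℕ → ℕ} M j → (M ≤ j → f j ≡ 0) → sumUpTo (λ i → δ j i * f i) M ≡ f j
sumUpTo-δ     zero    j       out = sym (out z≤n)
sumUpTo-δ {f} (suc M) zero    _   = begin
  (f 0 + 0) + sumUpTo (λ i → 0) M ≡⟨ cong₂ _+_ (+-identityʳ (f 0)) (sumUpTo-zero M (λ _ → refl)) ⟩
  f 0 + 0                         ≡⟨ +-identityʳ (f 0) ⟩
  f 0                             ∎
sumUpTo-δ     (suc M) (suc j) out = sumUpTo-δ M j (out ∘ s≤s)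

sumMap-sumUpTo : ∀ {A : Set} (f : ℕ → A → ℕ) M xs →
                 sumMap (λ x → sumUpTo (λ i → f i x) M) xs ≡ sumUpTo (λ i → sumMap (f i) xs) M
sumMap-sumUpTo f zero    xs = sumMap-zeroᴬ (All.universal (λ _ → refl) xs)
sumMap-sumUpTo f (suc M) xs =
  trans (sumMap-+ (f 0) _ xs) (cong (sumMap (f 0) xs +_) (sumMap-sumUpTo (f ∘ suc) M xs))

parts≤ : ℕ → ℕ → List (List ℕ)
parts≤ b n = partsUpTo n b n

partsUpTo-fuel : ∀ {f₁ f₂} b n → n ≤ f₁ → n ≤ f₂ → partsUpTo f₁ b n ≡ partsUpTo f₂ b n
partsUpTo-fuel b zero _ _ = refl
partsUpTo-fuel {suc f₁} {suc f₂} b (suc n) (s≤s n≤f₁) (s≤s n≤f₂) =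
  concatMap-cong (λ i → cong (λ ps → if ⌊ suc i ≤? suc n ⌋ then map (suc i ∷_) ps else [])
                             (partsUpTo-fuel (suc i) (n ∸ i) (≤-trans (m∸n≤m n i) n≤f₁) (≤-trans (m∸n≤m n i) n≤f₂)))
                 (upTo b)

sumWithLargest : (List ℕ → ℕ) → ℕ → ℕ → ℕ
sumWithLargest g n j = if ⌊ j ≤? n ⌋ then sumMap (g ∘ (j ∷_)) (parts≤ j (n ∸ j)) else 0

sumWithLargest-≤ : ∀ g {n j} → j ≤ n → sumWithLargest g n j ≡ sumMap (g ∘ (j ∷_)) (parts≤ j (n ∸ j))
sumWithLargest-≤ g {n} {j} j≤n with j ≤? n
... | yes _  = refl
... | no j≰n = contradiction j≤n j≰n

sumWithLargest-> : ∀ g {n j} → n < j → sumWithLargest g n j ≡ 0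
sumWithLargest-> g {n} {j} n<j with j ≤? n
... | yes j≤n = contradiction j≤n (<⇒≱ n<j)
... | no _    = refl

sumMap-parts≤-suc : ∀ b n (g : List ℕ → ℕ) →
                    sumMap g (parts≤ b (suc n)) ≡ sumUpTo (λ i → sumWithLargest g (suc n) (suc i)) b
sumMap-parts≤-suc b n g = begin
  sumMap g (concatMap byLargest (upTo b))                  ≡⟨ sumMap-concatMap g byLargest (upTo b) ⟩
  sumMap (sumMap g ∘ byLargest) (upTo b)                   ≡⟨ sumMap-cong largest (upTo b) ⟩
  sumMap (λ i → sumWithLargest g (suc n) (suc i)) (upTo b) ≡⟨ cong sum (map-upTo _ b) ⟩
  sumUpTo (λ i → sumWithLargest g (suc n) (suc i)) b       ∎
  where
  byLargest : ℕ → List (List ℕ)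
  byLargest i = if ⌊ suc i ≤? suc n ⌋ then map (suc i ∷_) (partsUpTo n (suc i) (n ∸ i)) else []
  largest : ∀ i → sumMap g (byLargest i) ≡ sumWithLargest g (suc n) (suc i)
  largest i with suc i ≤? suc n
  ... | yes _ = trans (sumMap-map g (suc i ∷_) (partsUpTo n (suc i) (n ∸ i)))
                      (cong (sumMap (g ∘ (suc i ∷_))) (partsUpTo-fuel (suc i) (n ∸ i) (m∸n≤m n i) ≤-refl))
  ... | no _  = refl

sumMap-parts≤-bound : ∀ {b c} n (g : List ℕ → ℕ) → n ≤ b → n ≤ c →
                      sumMap g (parts≤ b n) ≡ sumMap g (parts≤ c n)
sumMap-parts≤-bound         zero    g _   _   = refl
sumMap-parts≤-bound {b} {c} (suc n) g n<b n<c = begin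
  sumMap g (parts≤ b (suc n))                              ≡⟨ sumMap-parts≤-suc b n g ⟩
  sumUpTo (λ i → sumWithLargest g (suc n) (suc i)) b       ≡⟨ sumUpTo-truncate n<b tooLarge ⟩
  sumUpTo (λ i → sumWithLargest g (suc n) (suc i)) (suc n) ≡⟨ sumUpTo-truncate n<c tooLarge ⟨
  sumUpTo (λ i → sumWithLargest g (suc n) (suc i)) c       ≡⟨ sumMap-parts≤-suc c n g ⟨
  sumMap g (parts≤ c (suc n))                              ∎
  where
  tooLarge : ∀ i → suc n ≤ i → sumWithLargest g (suc n) (suc i) ≡ 0
  tooLarge i n<i = sumWithLargest-> g (s≤s n<i)

sumMap-parts≤-one : ∀ n (g : List ℕ → ℕ) → sumMap g (parts≤ 1 n) ≡ g (replicate n 1)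
sumMap-parts≤-one zero    g = +-identityʳ (g [])
sumMap-parts≤-one (suc n) g = begin
  sumMap g (parts≤ 1 (suc n))      ≡⟨ sumMap-parts≤-suc 1 n g ⟩
  sumWithLargest g (suc n) 1 + 0   ≡⟨ +-identityʳ _ ⟩
  sumWithLargest g (suc n) 1       ≡⟨ sumWithLargest-≤ g {suc n} (s≤s z≤n) ⟩
  sumMap (g ∘ (1 ∷_)) (parts≤ 1 n) ≡⟨ sumMap-parts≤-one n (g ∘ (1 ∷_)) ⟩
  g (replicate (suc n) 1)          ∎

sumWithLargest-one : ∀ n (g : List ℕ → ℕ) → sumWithLargest g (suc n) 1 ≡ g (replicate (suc n) 1)
sumWithLargest-one n g = trans (sumWithLargest-≤ g {suc n} (s≤s z≤n)) (sumMap-parts≤-one n (g ∘ (1 ∷_)))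

IsPartitionOf : ℕ → List ℕ → Set
IsPartitionOf n μ = All (0 <_) μ × sum μ ≡ n

IsPartitionOf-∷ : ∀ {i n μ} → i ≤ n → IsPartitionOf (n ∸ i) μ → IsPartitionOf (suc n) (suc i ∷ μ)
IsPartitionOf-∷ {i} i≤n (pos , sum≡) = z<s ∷ pos , cong suc (trans (cong (i +_) sum≡) (m+[n∸m]≡n i≤n))

partsUpTo-sound : ∀ f b n → All (IsPartitionOf n) (partsUpTo f b n)
partsUpTo-sound f       b zero    = ([] , refl) ∷ []
partsUpTo-sound zero    b (suc n) = []
partsUpTo-sound (suc f) b (suc n) = concat⁺ (map⁺ (All.universal largest (upTo b)))
  where
  largest : ∀ i → All (IsPartitionOf (suc n))
                      (if ⌊ suc i ≤? suc n ⌋ then map (suc i ∷_) (partsUpTo f (suc i) (n ∸ i)) else [])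
  largest i with suc i ≤? suc n
  ... | yes (s≤s i≤n) = map⁺ (All.map (IsPartitionOf-∷ i≤n) (partsUpTo-sound f (suc i) (n ∸ i)))
  ... | no _          = []

partition-length≤ : ∀ {n μ} → IsPartitionOf n μ → length μ ≤ n
partition-length≤ {μ = []}    _                  = z≤n
partition-length≤ {μ = x ∷ μ} (0<x ∷ pos , refl) = +-mono-≤ 0<x (partition-length≤ (pos , refl))

sumMap-parts≤-suc-cong : ∀ b n {f g : List ℕ → ℕ} → (∀ x xs → f (x ∷ xs) ≡ g (x ∷ xs)) →
                         sumMap f (parts≤ b (suc n)) ≡ sumMap g (parts≤ b (suc n))
sumMap-parts≤-suc-cong b n {f} {g} eq = sumMap-congᴬ (All.map nonEmpty (partsUpTo-sound (suc n) b (suc n)))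
  where
  nonEmpty : ∀ {μ} → IsPartitionOf (suc n) μ → f μ ≡ g μ
  nonEmpty {x ∷ xs} _ = eq x xs

sumMap-parts≤-suc-vanish : ∀ b n {g : List ℕ → ℕ} → (∀ x xs → g (x ∷ xs) ≡ 0) →
                           sumMap g (parts≤ b (suc n)) ≡ 0
sumMap-parts≤-suc-vanish b n vanish =
  trans (sumMap-parts≤-suc-cong b n vanish) (sumMap-zeroᴬ (All.universal (λ _ → refl) (parts≤ b (suc n))))

lastOr0-++ : ∀ xs y ys → lastOr0 (xs ++ y ∷ ys) ≡ lastOr0 (y ∷ ys)
lastOr0-++ []            y ys = refl
lastOr0-++ (x ∷ [])      y ys = refl
lastOr0-++ (x ∷ x′ ∷ xs) y ys = lastOr0-++ (x′ ∷ xs) y ys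

lastOr0-replicate : ∀ r x → lastOr0 (replicate (suc r) x) ≡ x
lastOr0-replicate zero    x = refl
lastOr0-replicate (suc r) x = lastOr0-replicate r x

lastOr0-map : ∀ (f : ℕ → ℕ) x xs → lastOr0 (map f (x ∷ xs)) ≡ f (lastOr0 (x ∷ xs))
lastOr0-map f x []       = refl
lastOr0-map f x (y ∷ xs) = lastOr0-map f y xs

count-map-suc : ∀ a xs → count (suc a) (map suc xs) ≡ count a xs
count-map-suc a xs = begin
  count (suc a) (map suc xs)              ≡⟨ length-filter≡sumMap (_≟ suc a) (map suc xs) ⟩
  sumMap (λ x → δ x (suc a)) (map suc xs) ≡⟨ sumMap-map (λ x → δ x (suc a)) suc xs ⟩
  sumMap (λ x → δ x a) xs                 ≡⟨ length-filter≡sumMap (_≟ a) xs ⟨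
  count a xs                              ∎

count-++ : ∀ a xs ys → count a (xs ++ ys) ≡ count a xs + count a ys
count-++ a xs ys = trans (cong length (filter-++ (_≟ a) xs ys)) (length-++ (filter (_≟ a) xs))

count-replicate : ∀ a r → count a (replicate r a) ≡ r
count-replicate a r = trans (cong length (filter-all (_≟ a) (replicate⁺ r refl))) (length-replicate r)

count-zero : ∀ {xs} → All (0 <_) xs → count 0 xs ≡ 0
count-zero pos = cong length (filter-none (_≟ 0) (All.map m<n⇒n≢0 pos))

smallestMult-map-suc : ∀ xs → smallestMult (map suc xs) ≡ smallestMult xs
smallestMult-map-suc []       = refl
smallestMult-map-suc (x ∷ xs) =
  trans (cong (λ a → count a (map suc (x ∷ xs))) (lastOr0-map suc x xs)) (count-map-suc _ (x ∷ xs))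

smallestMult-pad : ∀ {xs c} → All (0 <_) xs → 0 < c → smallestMult (map suc xs ++ replicate c 1) ≡ c
smallestMult-pad {xs} {suc r} pos _ = begin
  count (lastOr0 (map suc xs ++ replicate (suc r) 1)) (map suc xs ++ replicate (suc r) 1)
    ≡⟨ cong (λ a → count a (map suc xs ++ replicate (suc r) 1))
            (trans (lastOr0-++ (map suc xs) 1 (replicate r 1)) (lastOr0-replicate r 1)) ⟩
  count 1 (map suc xs ++ replicate (suc r) 1)
    ≡⟨ count-++ 1 (map suc xs) (replicate (suc r) 1) ⟩
  count 1 (map suc xs) + count 1 (replicate (suc r) 1)
    ≡⟨ cong₂ _+_ (trans (count-map-suc 0 xs) (count-zero pos)) (count-replicate 1 (suc r)) ⟩
  suc r
    ∎

exactly : ℕ → (List ℕ → ℕ) → List ℕ → ℕ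
exactly k g μ = δ (length μ) k * g μ

-- <? rather than ≤? so that atMost (suc k) g (x ∷ xs) computes to atMost k (g ∘ (x ∷_)) xs.
atMost : ℕ → (List ℕ → ℕ) → List ℕ → ℕ
atMost k g μ = ⟦ length μ <? suc k ⟧ * g μ

atMost-≤ : ∀ {k} g {μ} → length μ ≤ k → atMost k g μ ≡ g μ
atMost-≤ {k} g {μ} l≤k = trans (cong (_* g μ) (⟦⟧-yes (length μ <? suc k) (s≤s l≤k))) (*-identityˡ (g μ))

atMost-> : ∀ {k} g {μ} → k < length μ → atMost k g μ ≡ 0
atMost-> {k} g {μ} k<l = cong (_* g μ) (⟦⟧-no (length μ <? suc k) (λ l<1+k → <⇒≱ k<l (s≤s⁻¹ l<1+k)))

sumMap-exactly-< : ∀ {k b n} (g : List ℕ → ℕ) → n < k → sumMap (exactly k g) (parts≤ b n) ≡ 0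
sumMap-exactly-< {k} {b} {n} g n<k = sumMap-zeroᴬ (All.map tooFew (partsUpTo-sound n b n))
  where
  tooFew : ∀ {μ} → IsPartitionOf n μ → exactly k g μ ≡ 0
  tooFew {μ} π = cong (_* g μ) (δ-≢ (<⇒≢ (≤-<-trans (partition-length≤ π) n<k)))

addColumn : ℕ → List ℕ → List ℕ
addColumn k xs = map suc xs ++ replicate (k ∸ length xs) 1

atMost-addColumn : ∀ k {xs} → All (0 <_) xs →
                   atMost k (smallestMult ∘ addColumn k) xs ≡ exactly k smallestMult xs + (k ∸ length xs)
atMost-addColumn k {xs} pos with <-cmp (length xs) k
... | tri< l<k _ _ = begin
  atMost k (smallestMult ∘ addColumn k) xs ≡⟨ atMost-≤ (smallestMult ∘ addColumn k) {xs} (<⇒≤ l<k) ⟩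
  smallestMult (addColumn k xs)             ≡⟨ smallestMult-pad pos (m<n⇒0<n∸m l<k) ⟩
  k ∸ length xs                             ≡⟨ cong (λ e → e * smallestMult xs + (k ∸ length xs)) (δ-≢ (<⇒≢ l<k)) ⟨
  exactly k smallestMult xs + (k ∸ length xs) ∎
... | tri≈ _ refl _ = begin
  atMost k (smallestMult ∘ addColumn k) xs           ≡⟨ atMost-≤ (smallestMult ∘ addColumn k) {xs} ≤-refl ⟩
  smallestMult (map suc xs ++ replicate (k ∸ k) 1)   ≡⟨ cong (λ c → smallestMult (map suc xs ++ replicate c 1)) (n∸n≡0 k) ⟩
  smallestMult (map suc xs ++ [])                    ≡⟨ cong smallestMult (++-identityʳ (map suc xs)) ⟩
  smallestMult (map suc xs)                          ≡⟨ smallestMult-map-suc xs ⟩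
  smallestMult xs                                    ≡⟨ *-identityˡ (smallestMult xs) ⟨
  1 * smallestMult xs                                ≡⟨ +-identityʳ (1 * smallestMult xs) ⟨
  1 * smallestMult xs + 0                            ≡⟨ cong₂ (λ e c → e * smallestMult xs + c) (δ-refl k) (n∸n≡0 k) ⟨
  exactly k smallestMult xs + (k ∸ k) ∎
... | tri> _ _ k<l = begin
  atMost k (smallestMult ∘ addColumn k) xs      ≡⟨ atMost-> (smallestMult ∘ addColumn k) {xs} k<l ⟩
  0                                             ≡⟨ cong₂ (λ e c → e * smallestMult xs + c) (δ-≢ (>⇒≢ k<l)) (m≤n⇒m∸n≡0 (<⇒≤ k<l)) ⟨
  exactly k smallestMult xs + (k ∸ length xs)   ∎

sumWithLargest-exactly-vanish : ∀ {k} n j (g : List ℕ → ℕ) → (j ≤ n → n ∸ j < k) →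
                                sumWithLargest (exactly (suc k) g) n j ≡ 0
sumWithLargest-exactly-vanish {k} n j g short with j ≤? n
... | yes j≤n = sumMap-exactly-< (g ∘ (j ∷_)) (short j≤n)
... | no _    = refl

[m+o]∸n<o : ∀ {m n} o → m < n → n ≤ m + o → m + o ∸ n < o
[m+o]∸n<o {m} {n} o m<n n≤m+o = subst (m + o ∸ n <_) (m+n∸m≡n n o) (∸-monoˡ-< (+-monoˡ-< o m<n) n≤m+o)

-- Under addColumn k, largest part j of a partition of N becomes largest part j + 1,
-- so both sides are unfolded along their largest parts in step.
sumMap-exactly-addColumn : ∀ k b N (g : List ℕ → ℕ) →
  sumMap (exactly k g) (parts≤ (suc b) (N + k)) ≡ sumMap (atMost k (g ∘ addColumn k)) (parts≤ b N)
sumMap-exactly-addColumn zero b N g =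
  trans (cong (λ n → sumMap (exactly 0 g) (parts≤ (suc b) n)) (+-identityʳ N)) (noParts N)
  where
  noParts : ∀ N → sumMap (exactly 0 g) (parts≤ (suc b) N) ≡ sumMap (atMost 0 (g ∘ addColumn 0)) (parts≤ b N)
  noParts zero    = refl
  noParts (suc N) = trans (sumMap-parts≤-suc-vanish (suc b) N (λ _ _ → refl))
                          (sym (sumMap-parts≤-suc-vanish b N (λ _ _ → refl)))
sumMap-exactly-addColumn (suc k) b N g =
  trans (cong (λ n → sumMap f (parts≤ (suc b) n)) (+-suc N k)) (shifted N)
  where
  f h : List ℕ → ℕ
  f = exactly (suc k) g
  h = atMost (suc k) (g ∘ addColumn (suc k))

  onlyOnes : ∀ n → sumWithLargest f (suc n) 1 ≡ δ n k * g (replicate (suc n) 1)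
  onlyOnes n = trans (sumWithLargest-one n f)
                     (cong (λ l → δ l k * g (replicate (suc n) 1)) (length-replicate n))

  shifted : ∀ N → sumMap f (parts≤ (suc b) (suc (N + k))) ≡ sumMap h (parts≤ b N)
  shifted zero = begin
    sumMap f (parts≤ (suc b) (suc k))
      ≡⟨ sumMap-parts≤-suc (suc b) k f ⟩
    sumWithLargest f (suc k) 1 + sumUpTo (λ i → sumWithLargest f (suc k) (suc (suc i))) b
      ≡⟨ cong₂ _+_ (onlyOnes k) (sumUpTo-zero b tooShort) ⟩
    δ k k * g (replicate (suc k) 1) + 0
      ≡⟨ cong (λ e → e * g (replicate (suc k) 1) + 0) (δ-refl k) ⟩
    sumMap h (parts≤ b 0)
      ∎
    where
    tooShort : ∀ i → sumWithLargest f (suc k) (suc (suc i)) ≡ 0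
    tooShort i = sumWithLargest-exactly-vanish (suc k) (suc (suc i)) g (λ { (s≤s i<k) → ∸-monoʳ-< z<s i<k })
  shifted (suc N) = begin
    sumMap f (parts≤ (suc b) (suc (suc N + k)))
      ≡⟨ sumMap-parts≤-suc (suc b) (suc N + k) f ⟩
    sumWithLargest f (suc (suc N + k)) 1 + sumUpTo (λ i → sumWithLargest f (suc (suc N + k)) (suc (suc i))) b
      ≡⟨ cong₂ _+_ notOnes (sumUpTo-cong b largest) ⟩
    sumUpTo (λ i → sumWithLargest h (suc N) (suc i)) b
      ≡⟨ sumMap-parts≤-suc b N h ⟨
    sumMap h (parts≤ b (suc N))
      ∎
    where
    notOnes : sumWithLargest f (suc (suc N + k)) 1 ≡ 0
    notOnes = trans (onlyOnes (suc N + k))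
                    (cong (_* g (replicate (suc (suc N + k)) 1)) (δ-≢ {suc N + k} (m≢1+n+m k ∘ sym)))
    largest : ∀ i → sumWithLargest f (suc (suc N + k)) (suc (suc i)) ≡ sumWithLargest h (suc N) (suc i)
    largest i with i ≤? N
    ... | yes i≤N = begin
      sumWithLargest f (suc (suc N + k)) (suc (suc i))
        ≡⟨ sumWithLargest-≤ f (s≤s (s≤s (≤-trans i≤N (m≤m+n N k)))) ⟩
      sumMap (exactly k g′) (parts≤ (suc (suc i)) (N + k ∸ i))
        ≡⟨ cong (λ n → sumMap (exactly k g′) (parts≤ (suc (suc i)) n)) (+-∸-comm k i≤N) ⟩
      sumMap (exactly k g′) (parts≤ (suc (suc i)) (N ∸ i + k))
        ≡⟨ sumMap-exactly-addColumn k (suc i) (N ∸ i) g′ ⟩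
      sumMap (h ∘ (suc i ∷_)) (parts≤ (suc i) (N ∸ i))
        ≡⟨ sumWithLargest-≤ h (s≤s i≤N) ⟨
      sumWithLargest h (suc N) (suc i)
        ∎
      where
      g′ : List ℕ → ℕ
      g′ = g ∘ (suc (suc i) ∷_)
    ... | no i≰N = trans (sumWithLargest-exactly-vanish (suc (suc N + k)) (suc (suc i)) g short)
                         (sym (sumWithLargest-> h (s≤s (≰⇒> i≰N))))
      where
      short : suc (suc i) ≤ suc (suc N + k) → N + k ∸ i < k
      short (s≤s (s≤s i≤N+k)) = [m+o]∸n<o k (≰⇒> i≰N) i≤N+k

spt[_] : ℕ → ℕ → ℕ
spt[ k ] n = sumMap (exactly k smallestMult) (partitions n)

deficit : ℕ → ℕ → ℕ
deficit k n = sumMap (λ μ → k ∸ length μ) (partitions n)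

spt≡Σspt[k] : ∀ n → spt n ≡ sumUpTo (λ i → spt[ suc i ] n) n
spt≡Σspt[k] n = trans (sumMap-congᴬ (All.map (λ {μ} π → byLength {μ} (partition-length≤ π)) (partsUpTo-sound n n n)))
                      (sumMap-sumUpTo (λ i → exactly (suc i) smallestMult) n (partitions n))
  where
  byLength : ∀ {μ} → length μ ≤ n → smallestMult μ ≡ sumUpTo (λ i → exactly (suc i) smallestMult μ) n
  byLength {[]}     _   = sym (sumUpTo-zero n (λ _ → refl))
  byLength {x ∷ xs} l<n = sym (sumUpTo-δ n (length xs) (λ n≤l → contradiction l<n (<⇒≱ (s≤s n≤l))))

spt[k]-shift : ∀ k N → spt[ k ] (N + k) ≡ spt[ k ] N + deficit k N
spt[k]-shift k N = begin
  sumMap (exactly k smallestMult) (parts≤ (N + k) (N + k))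
    ≡⟨ sumMap-parts≤-bound (N + k) (exactly k smallestMult) ≤-refl (n≤1+n (N + k)) ⟩
  sumMap (exactly k smallestMult) (parts≤ (suc (N + k)) (N + k))
    ≡⟨ sumMap-exactly-addColumn k (N + k) N smallestMult ⟩
  sumMap (atMost k (smallestMult ∘ addColumn k)) (parts≤ (N + k) N)
    ≡⟨ sumMap-parts≤-bound N (atMost k (smallestMult ∘ addColumn k)) (m≤m+n N k) ≤-refl ⟩
  sumMap (atMost k (smallestMult ∘ addColumn k)) (partitions N)
    ≡⟨ sumMap-congᴬ (All.map (atMost-addColumn k ∘ proj₁) (partsUpTo-sound N N N)) ⟩
  sumMap (λ μ → exactly k smallestMult μ + (k ∸ length μ)) (partitions N)
    ≡⟨ sumMap-+ (exactly k smallestMult) (λ μ → k ∸ length μ) (partitions N) ⟩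
  spt[ k ] N + deficit k N
    ∎

∸-*-suc : ∀ r K q m → r + K * suc q ∸ K * suc m ≡ r + K * q ∸ K * m
∸-*-suc r K q m = begin
  r + K * suc q ∸ K * suc m         ≡⟨ cong₂ (λ a b → r + a ∸ b) (*-suc K q) (*-suc K m) ⟩
  r + (K + K * q) ∸ (K + K * m)     ≡⟨ cong (_∸ (K + K * m)) (x∙yz≈y∙xz r K (K * q)) ⟩
  K + (r + K * q) ∸ (K + K * m)     ≡⟨ [m+n]∸[m+o]≡n∸o K (r + K * q) (K * m) ⟩
  r + K * q ∸ K * m                 ∎

Σ-countdown : ∀ (f : ℕ → ℕ) r K q →
  Σ[1‥ suc q ] (λ m → f (r + K * suc q ∸ K * m)) ≡ f (r + K * q) + Σ[1‥ q ] (λ m → f (r + K * q ∸ K * m))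
Σ-countdown f r K q =
  cong₂ _+_ (cong f (trans (∸-*-suc r K q 0) (cong (r + K * q ∸_) (*-zeroʳ K))))
            (sumUpTo-cong q (λ i → cong f (∸-*-suc r K q (suc i))))

spt[k]-unroll : ∀ K q r → r < K → spt[ K ] (r + K * q) ≡ Σ[1‥ q ] (λ m → deficit K (r + K * q ∸ K * m))
spt[k]-unroll K zero r r<K =
  sumMap-exactly-< smallestMult (subst (_< K) (sym (trans (cong (r +_) (*-zeroʳ K)) (+-identityʳ r))) r<K)
spt[k]-unroll K (suc q) r r<K = begin
  spt[ K ] (r + K * suc q)
    ≡⟨ cong spt[ K ] (trans (cong (r +_) (trans (*-suc K q) (+-comm K (K * q)))) (sym (+-assoc r (K * q) K))) ⟩
  spt[ K ] (r + K * q + K)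
    ≡⟨ spt[k]-shift K (r + K * q) ⟩
  spt[ K ] (r + K * q) + deficit K (r + K * q)
    ≡⟨ +-comm _ (deficit K (r + K * q)) ⟩
  deficit K (r + K * q) + spt[ K ] (r + K * q)
    ≡⟨ cong (deficit K (r + K * q) +_) (spt[k]-unroll K q r r<K) ⟩
  deficit K (r + K * q) + Σ[1‥ q ] (λ m → deficit K (r + K * q ∸ K * m))
    ≡⟨ Σ-countdown (deficit K) r K q ⟨
  Σ[1‥ suc q ] (λ m → deficit K (r + K * suc q ∸ K * m))
    ∎

Σ-p-zero : ∀ k → Σ[1‥ k ] (λ ν → (suc k ∸ ν) * p 0 ν) ≡ k
Σ-p-zero zero    = refl
Σ-p-zero (suc k) = begin
  suc k * 1 + Σ[1‥ k ] (λ ν → (suc k ∸ ν) * p 0 (suc ν))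
    ≡⟨ cong₂ _+_ (*-identityʳ (suc k)) (sumUpTo-zero k (λ i → *-zeroʳ (k ∸ i))) ⟩
  suc k + 0
    ≡⟨ +-identityʳ (suc k) ⟩
  suc k
    ∎

deficit-split : ∀ k N → deficit (suc k) N ≡ Σ[1‥ k ] (λ ν → (suc k ∸ ν) * p N ν) + ⟦ N ≟ 0 ⟧
deficit-split k zero = begin
  suc k + 0                                     ≡⟨ +-identityʳ (suc k) ⟩
  suc k                                         ≡⟨ +-comm 1 k ⟩
  k + 1                                         ≡⟨ cong (_+ 1) (Σ-p-zero k) ⟨
  Σ[1‥ k ] (λ ν → (suc k ∸ ν) * p 0 ν) + 1      ∎
deficit-split k (suc N) = sym (begin
  Σ[1‥ k ] (λ ν → (suc k ∸ ν) * p (suc N) ν) + 0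
    ≡⟨ +-identityʳ _ ⟩
  sumUpTo (λ i → (k ∸ i) * p (suc N) (suc i)) k
    ≡⟨ sumUpTo-cong k (λ i → cong ((k ∸ i) *_) (length-filter≡sumMap (λ μ → length μ ≟ suc i) P)) ⟩
  sumUpTo (λ i → (k ∸ i) * sumMap (λ μ → δ (length μ) (suc i)) P) k
    ≡⟨ sumUpTo-cong k (λ i → sumMap-*ˡ (k ∸ i) (λ μ → δ (length μ) (suc i)) P) ⟨
  sumUpTo (λ i → sumMap (λ μ → (k ∸ i) * δ (length μ) (suc i)) P) k
    ≡⟨ sumMap-sumUpTo (λ i μ → (k ∸ i) * δ (length μ) (suc i)) k P ⟨
  sumMap (λ μ → sumUpTo (λ i → (k ∸ i) * δ (length μ) (suc i)) k) P
    ≡⟨ sumMap-parts≤-suc-cong (suc N) N pick ⟩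
  deficit (suc k) (suc N) ∎)
  where
  P : List (List ℕ)
  P = partitions (suc N)
  pick : ∀ x xs → sumUpTo (λ i → (k ∸ i) * δ (length xs) i) k ≡ k ∸ length xs
  pick x xs = trans (sumUpTo-cong k (λ i → *-comm (k ∸ i) (δ (length xs) i))) (sumUpTo-δ k (length xs) m≤n⇒m∸n≡0)

Σ-multiples-isZero : ∀ k q r → 0 < q → Σ[1‥ q ] (λ m → ⟦ r + suc k * q ∸ suc k * m ≟ 0 ⟧) ≡ ⟦ r ≟ 0 ⟧
Σ-multiples-isZero k (suc zero) r _ = begin
  Σ[1‥ 1 ] (λ m → ⟦ r + suc k * 1 ∸ suc k * m ≟ 0 ⟧) ≡⟨ Σ-countdown (λ n → ⟦ n ≟ 0 ⟧) r (suc k) 0 ⟩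
  ⟦ r + suc k * 0 ≟ 0 ⟧ + 0                          ≡⟨ +-identityʳ _ ⟩
  ⟦ r + suc k * 0 ≟ 0 ⟧                              ≡⟨ cong (λ n → ⟦ n ≟ 0 ⟧) r+k*0≡r ⟩
  ⟦ r ≟ 0 ⟧                                          ∎
  where
  r+k*0≡r : r + suc k * 0 ≡ r
  r+k*0≡r = trans (cong (r +_) (*-zeroʳ (suc k))) (+-identityʳ r)
Σ-multiples-isZero k (suc (suc q)) r _ = begin
  Σ[1‥ suc (suc q) ] (λ m → ⟦ r + suc k * suc (suc q) ∸ suc k * m ≟ 0 ⟧)
    ≡⟨ Σ-countdown (λ n → ⟦ n ≟ 0 ⟧) r (suc k) (suc q) ⟩
  ⟦ r + suc k * suc q ≟ 0 ⟧ + Σ[1‥ suc q ] (λ m → ⟦ r + suc k * suc q ∸ suc k * m ≟ 0 ⟧)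
    ≡⟨ cong₂ _+_ (cong (λ n → ⟦ n ≟ 0 ⟧) (+-suc r (q + k * suc q))) (Σ-multiples-isZero k (suc q) r z<s) ⟩
  ⟦ r ≟ 0 ⟧ ∎

m≡m%n+n*[m/n] : ∀ m n .{{_ : NonZero n}} → m ≡ m % n + n * (m / n)
m≡m%n+n*[m/n] m n = trans (m≡m%n+[m/n]*n m n) (cong (m % n +_) (*-comm (m / n) n))

spt[k]≡Σdeficit : ∀ n k → spt[ suc k ] n ≡ Σ[1‥ n / suc k ] (λ m → deficit (suc k) (n ∸ suc k * m))
spt[k]≡Σdeficit n k =
  subst (λ x → spt[ suc k ] x ≡ Σ[1‥ n / suc k ] (λ m → deficit (suc k) (x ∸ suc k * m)))
        (sym (m≡m%n+n*[m/n] n (suc k))) (spt[k]-unroll (suc k) (n / suc k) (n % suc k) (m%n<n n (suc k)))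

-- ⟦ suc k ∣? n ⟧ computes to ⟦ n % suc k ≟ 0 ⟧.
Σ-multiples≡divides : ∀ n k → k < n → Σ[1‥ n / suc k ] (λ m → ⟦ n ∸ suc k * m ≟ 0 ⟧) ≡ ⟦ suc k ∣? n ⟧
Σ-multiples≡divides n k k<n =
  subst (λ x → Σ[1‥ n / suc k ] (λ m → ⟦ x ∸ suc k * m ≟ 0 ⟧) ≡ ⟦ n % suc k ≟ 0 ⟧)
        (sym (m≡m%n+n*[m/n] n (suc k))) (Σ-multiples-isZero k (n / suc k) (n % suc k) (m≥n⇒m/n>0 k<n))

d≡Σdivides : ∀ n → d n ≡ sumUpTo (λ i → ⟦ suc i ∣? n ⟧) n
d≡Σdivides n = trans (length-filter≡sumMap (_∣? n) (applyUpTo suc n)) (cong sum (map-applyUpTo suc _ n))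

corollary5 : (n : ℕ) → 1 ≤ n → spt n ≡ d n + Σ⁺[1‥ n ] (λ k → Σ[1‥ n / k ] (λ m → Σ[1‥ k ∸ 1 ] (λ ν → (k ∸ ν) * p (n ∸ k * m) ν)))
corollary5 n _ = begin
  spt n
    ≡⟨ spt≡Σspt[k] n ⟩
  sumUpTo (λ i → spt[ suc i ] n) n
    ≡⟨ sumUpTo-cong n split ⟩
  sumUpTo (λ i → weighted i + multiples i) n
    ≡⟨ sumUpTo-+ weighted multiples n ⟩
  sumUpTo weighted n + sumUpTo multiples n
    ≡⟨ cong (sumUpTo weighted n +_) (trans (sumUpTo-cong< n (Σ-multiples≡divides n)) (sym (d≡Σdivides n))) ⟩
  sumUpTo weighted n + d n
    ≡⟨ +-comm _ (d n) ⟩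
  d n + sumUpTo weighted n
    ∎
  where
  weighted multiples : ℕ → ℕ
  weighted k  = Σ[1‥ n / suc k ] (λ m → Σ[1‥ k ] (λ ν → (suc k ∸ ν) * p (n ∸ suc k * m) ν))
  multiples k = Σ[1‥ n / suc k ] (λ m → ⟦ n ∸ suc k * m ≟ 0 ⟧)
  split : ∀ k → spt[ suc k ] n ≡ weighted k + multiples k
  split k = begin
    spt[ suc k ] n
      ≡⟨ spt[k]≡Σdeficit n k ⟩
    Σ[1‥ n / suc k ] (λ m → deficit (suc k) (n ∸ suc k * m))
      ≡⟨ sumUpTo-cong (n / suc k) (λ m → deficit-split k (n ∸ suc k * suc m)) ⟩
    Σ[1‥ n / suc k ] (λ m → Σ[1‥ k ] (λ ν → (suc k ∸ ν) * p (n ∸ suc k * m) ν) + ⟦ n ∸ suc k * m ≟ 0 ⟧)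
      ≡⟨ sumUpTo-+ _ _ (n / suc k) ⟩
    weighted k + multiples k
      ∎
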